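{- Let $t \geq 4$, $k=t-1$, and $n \geq 2k^2+4k$. Consider the Zeckendorf game on $n$ with $p=tk$ players divided into $t$ teams, each consisting of exactly $k$ consecutive players. Then no team has a winning strategy.
   Context: Let $F_1=1$, $F_2=2$, $F_{i+1}=F_i+F_{i-1}$. The Zeckendorf game on $n$ starts with the multiset of $n$ copies of $1$. A move is one of: if the list contains $F_{i-1}$ and $F_i$, replace them by $F_{i+1}$; if the list contains two copies of $F_i$: for $i=1$ replace them by $F_2$; for $i=2$ replace them by $F_1,F_3$; for $i\geq 3$ replace them by $F_{i-2},F_{i+1}$. The game ends when the list is the Zeckendorf decomposition of $n$ (distinct, pairwise non-consecutive Fibonacci numbers); every game terminates. With $p$ players, players $1,\dots,p$ move in cyclic order $1,2,\dots,p,1,2,\dots$ starting with player 1; players $i$ and $i+1 \pmod p$ are consecutive. A team wins if the final move is made by one of its members; it has a winning strategy if its members can choose their moves so that the final move is made by a member no matter what moves the other players make. -}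

module Defs where

open import Data.Nat using (ℕ; zero; suc; _+_; _*_; _∸_; _≤_; _<_)
open import Data.List using (List; []; _∷_; map; replicate)
open import Data.Nat.ListAction using (sum)
open import Data.List.Membership.Propositional using (_∈_; _∉_)
open import Data.List.Relation.Unary.Unique.Propositional using (Unique)
open import Data.List.Relation.Binary.Permutation.Propositional using (_↭_)
open import Data.Product using (Σ; ∃; _×_; _,_)
open import Data.Sum using (_⊎_)
open import Relation.Nullary using (¬_)
open import Relation.Binary.PropositionalEquality using (_≡_)

-- Fibonacci numbers with the paper's indexing: F 1 = 1, F 2 = 2,
-- F (i+1) = F i + F (i-1).  (F 0 = 1 is an unused junk value.)
F : ℕ → ℕ
F 0 = 1
F 1 = 1
F 2 = 2
F (suc (suc (suc i))) = F (suc (suc i)) + F (suc i)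

-- A game state is a multiset of Fibonacci numbers, represented as a list
-- of indices i (each i ≥ 1 standing for F i); order is irrelevant, all
-- relations below are stated up to permutation (_↭_).
State : Set
State = List ℕ

value : State → ℕ
value s = sum (map F s)

start : ℕ → State
start n = replicate n 1

data Move (s s' : State) : Set where
  -- F (i-1), F i  ↦  F (i+1)   (i ≥ 2, written i = suc j with j ≥ 1)
  combine : ∀ j r → 1 ≤ j → s ↭ (j ∷ suc j ∷ r) → s' ↭ (suc (suc j) ∷ r) → Move s s'
  split1  : ∀ r → s ↭ (1 ∷ 1 ∷ r) → s' ↭ (2 ∷ r) → Move s s'
  split2  : ∀ r → s ↭ (2 ∷ 2 ∷ r) → s' ↭ (1 ∷ 3 ∷ r) → Move s s'
  splitN  : ∀ i r → 3 ≤ i → s ↭ (i ∷ i ∷ r) → s' ↭ ((i ∸ 2) ∷ suc i ∷ r) → Move s s'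

IsZeckendorfOf : ℕ → State → Set
IsZeckendorfOf n s = Unique s × (∀ {i} → i ∈ s → suc i ∉ s) × value s ≡ n

SameMod : ℕ → ℕ → ℕ → Set
SameMod p x y = ∃ λ q₁ → ∃ λ q₂ → x + q₁ * p ≡ y + q₂ * p

-- With p players numbered 0,…,p-1 (player j here is player j+1 of the
-- paper), move number m (0-based) is made by player m mod p.
-- The team of k cyclically consecutive players starting at player a:
-- move m is made by a member iff m ≡ a + i (mod p) for some i < k.
InTeam : (p k a : ℕ) → ℕ → Set
InTeam p k a m = ∃ λ i → i < k × SameMod p m (a + i)

-- Win n T s m : in the Zeckendorf game on n, in state s after m moves
-- (so move number m, 0-based, is next), the team T (a predicate on move
-- numbers: "move m is made by a team member") can force that the final
-- move is made by a member, whatever the other players do.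
-- Since every game terminates, this inductive (well-founded) definition
-- captures exactly the existence of a winning strategy.
data Win (n : ℕ) (T : ℕ → Set) : State → ℕ → Set where
  ended  : ∀ {s m} → IsZeckendorfOf n s → T m → Win n T s (suc m)
  ours   : ∀ {s s' m} → ¬ IsZeckendorfOf n s → T m → Move s s'
         → Win n T s' (suc m) → Win n T s m
  theirs : ∀ {s m} → ¬ IsZeckendorfOf n s → ¬ T m
         → (∀ s' → Move s s' → Win n T s' (suc m)) → Win n T s m

HasWinningStrategy : (n p k a : ℕ) → Set
HasWinningStrategy n p k a = Win n (InTeam p k a) (start n) 0

-- The non-members of a team move in long uninterrupted stretches, and while
-- the position still holds plenty of 1s they can merge three 1s into a 3 either
-- in two moves (1+1 → 2, 2+1 → 3) or in three (1+1 → 2 twice, then 2+2 → 1+3),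
-- reaching the same position either way.  Chaining K such gadgets, they reach
-- one position Z at every time from m + 2K to m + 3K.  If the team won from Z
-- both at time m' and at time m' + K, then the team and its translate by K
-- seats, which are disjoint since 2K ≤ p, would both have winning strategies
-- from Z at time m'; playing these against each other ends with a move made by
-- a member of both, which is absurd.  So it suffices to reach, without spending
-- too many 1s, a time followed by 3K moves of non-members.  If the team plays
-- early, the non-members moving before it save 1s by building 3s, spending
-- three 1s per two moves.
module Submission where

open import Defs
open import Data.Nat
open import Data.Nat.Properties
open import Data.Nat.DivMod using (_%_; _/_; [m+kn]%n≡m%n; m<n⇒m%n≡m; m≡m%n+[m/n]*n)
open import Data.Nat.ListAction using (sum)
open import Data.Nat.ListAction.Properties using (sum-↭)
open import Data.Nat.Tactic.RingSolver using (solve-∀)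
open import Data.List using ([]; _∷_; map; replicate; _++_)
open import Data.List.Membership.Propositional using (_∈_; _∉_; find; lose)
open import Data.List.Membership.Propositional.Properties using (∈-∃++)
open import Data.List.Membership.DecPropositional _≟_ using (_∈?_)
open import Data.List.Relation.Unary.Any using (here; there; any?)
open import Data.List.Relation.Unary.All as All using (All; []; _∷_)
open import Data.List.Relation.Unary.All.Properties using (¬Any⇒All¬)
open import Data.List.Relation.Unary.AllPairs using ([]; _∷_)
open import Data.List.Relation.Unary.Unique.Propositional using (Unique)
open import Data.List.Relation.Unary.Unique.Propositional.Properties using (Unique[x∷xs]⇒x∉xs)
open import Data.List.Relation.Binary.Permutation.Propositional
  using (_↭_; ↭-refl; ↭-sym; ↭-trans; prep; swap; ↭⇒↭ₛ)
open import Data.List.Relation.Binary.Permutation.Propositional.Properties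
  using (All-resp-↭; ∈-resp-↭; map⁺; shift)
import Data.List.Relation.Binary.Permutation.Setoid.Properties as Setoid↭
open import Data.Product using (∃; _×_; _,_)
open import Data.Sum using (_⊎_; inj₁; inj₂)
open import Data.Empty using (⊥; ⊥-elim)
open import Relation.Nullary using (¬_; yes; no)
open import Relation.Binary.PropositionalEquality
  using (_≡_; setoid; refl; sym; trans; cong; subst; module ≡-Reasoning)

private variable
  n m x i : ℕ
  T A B : ℕ → Set
  r s s' : State

value-↭ : s ↭ s' → value s ≡ value s'
value-↭ p = sum-↭ (map⁺ F p)

-- Also at j = 0, thanks to the junk value F 0 = 1.
F-suc : ∀ j → F (suc (suc j)) ≡ F (suc j) + F j
F-suc zero    = refl
F-suc (suc j) = refl

value-move : Move s s' → value s' ≡ value s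
value-move (combine j r _ p q) = begin
  _                             ≡⟨ value-↭ q ⟩
  F (2 + j) + value r           ≡⟨ cong (_+ value r) (trans (F-suc j) (+-comm _ (F j))) ⟩
  F j + F (1 + j) + value r     ≡⟨ +-assoc (F j) _ _ ⟩
  F j + (F (1 + j) + value r)   ≡⟨ value-↭ p ⟨
  _                             ∎
  where open ≡-Reasoning
value-move (split1 r p q) = trans (value-↭ q) (sym (value-↭ p))
value-move (split2 r p q) = trans (value-↭ q) (sym (value-↭ p))
value-move (splitN 1 r (s≤s ()) p q)
value-move (splitN 2 r (s≤s (s≤s ())) p q)
value-move (splitN (suc (suc (suc i))) r _ p q) = begin
  _                               ≡⟨ value-↭ q ⟩
  a + ((b + a + b) + value r)     ≡⟨ doubling a b (value r) ⟩
  (b + a) + ((b + a) + value r)   ≡⟨ value-↭ p ⟨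
  _                               ∎
  where
  open ≡-Reasoning
  a b : ℕ
  a = F (suc i)
  b = F (suc (suc i))
  doubling : ∀ a b v → a + ((b + a + b) + v) ≡ (b + a) + ((b + a) + v)
  doubling = solve-∀

positive-move : Move s s' → All (1 ≤_) s → All (1 ≤_) s'
positive-move (combine j r _ p q) pos with _ ∷ _ ∷ pos-r ← All-resp-↭ p pos =
  All-resp-↭ (↭-sym q) (z<s ∷ pos-r)
positive-move (split1 r p q) pos with _ ∷ _ ∷ pos-r ← All-resp-↭ p pos =
  All-resp-↭ (↭-sym q) (z<s ∷ pos-r)
positive-move (split2 r p q) pos with _ ∷ _ ∷ pos-r ← All-resp-↭ p pos =
  All-resp-↭ (↭-sym q) (z<s ∷ z<s ∷ pos-r)
positive-move (splitN i r 3≤i p q) pos with _ ∷ _ ∷ pos-r ← All-resp-↭ p pos =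
  All-resp-↭ (↭-sym q) (∸-monoˡ-≤ 2 3≤i ∷ z<s ∷ pos-r)

Legal : ℕ → State → Set
Legal n s = All (1 ≤_) s × value s ≡ n

legal-start : ∀ n → Legal n (start n)
legal-start zero    = [] , refl
legal-start (suc n) with pos , val ← legal-start n = z<s ∷ pos , cong suc val

legal-move : Move s s' → Legal n s → Legal n s'
legal-move mv (pos , val) = positive-move mv pos , trans (value-move mv) val

isOne : ℕ → ℕ
isOne 1 = 1
isOne _ = 0

ones : State → ℕ
ones s = sum (map isOne s)

ones-↭ : s ↭ s' → ones s ≡ ones s'
ones-↭ p = sum-↭ (map⁺ isOne p)

ones-start : ∀ n → ones (start n) ≡ n
ones-start zero    = refl
ones-start (suc n) = cong suc (ones-start n)

ones-∷ : ∀ x s → ones s ≤ ones (x ∷ s)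
ones-∷ x s = m≤n+m (ones s) (isOne x)

ones-tail : s ↭ x ∷ r → ones r ≤ ones s
ones-tail {x = x} {r} p = ≤-trans (ones-∷ x r) (≤-reflexive (sym (ones-↭ p)))

ones-replace-pair : ∀ {x y} → s ↭ x ∷ y ∷ r → ones r ≤ ones s' → ones s ≤ 2 + ones s'
ones-replace-pair {s} {r} {s'} {x} {y} p r≤s' = begin
  ones s                        ≡⟨ ones-↭ p ⟩
  isOne x + (isOne y + ones r)  ≡⟨ +-assoc (isOne x) _ _ ⟨
  isOne x + isOne y + ones r    ≤⟨ +-monoˡ-≤ (ones r) (+-mono-≤ (isOne≤1 x) (isOne≤1 y)) ⟩
  2 + ones r                    ≤⟨ +-monoʳ-≤ 2 r≤s' ⟩
  2 + ones s'                   ∎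
  where
  open ≤-Reasoning
  isOne≤1 : ∀ x → isOne x ≤ 1
  isOne≤1 0             = z≤n
  isOne≤1 1             = ≤-refl
  isOne≤1 (suc (suc _)) = z≤n

ones-move : Move s s' → ones s ≤ 2 + ones s'
ones-move {s' = s'} (combine j r _ p q) = ones-replace-pair {s' = s'} p (ones-tail q)
ones-move {s' = s'} (split1 r p q)      = ones-replace-pair {s' = s'} p (ones-tail q)
ones-move {s' = s'} (split2 r p q)      =
  ones-replace-pair {s' = s'} p (≤-trans (ones-∷ 3 r) (ones-tail q))
ones-move {s' = s'} (splitN i r _ p q)  =
  ones-replace-pair {s' = s'} p (≤-trans (ones-∷ (suc i) r) (ones-tail q))

withOnes : ℕ → State → State
withOnes u R = replicate u 1 ++ R

ones-withOnes : ∀ u R → ones (withOnes u R) ≡ u + ones R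
ones-withOnes zero    R = refl
ones-withOnes (suc u) R = cong suc (ones-withOnes u R)

withOnes-∷ : ∀ u x R → withOnes u (x ∷ R) ↭ x ∷ withOnes u R
withOnes-∷ u x R = shift x (replicate u 1) R

withOnes-split-∷ : ∀ {c} y → (∃ λ R → s ↭ withOnes c R) → ∃ λ R → y ∷ s ↭ withOnes c R
withOnes-split-∷ {c = c} y (R , p) = y ∷ R , ↭-trans (prep y p) (↭-sym (withOnes-∷ c y R))

withOnes-split : ∀ c s → c ≤ ones s → ∃ λ R → s ↭ withOnes c R
withOnes-split zero    s                 _       = s , ↭-refl
withOnes-split (suc c) (1 ∷ s)           (s≤s h) with R , p ← withOnes-split c s h = R , prep 1 p
withOnes-split (suc c) (0 ∷ s)           h       = withOnes-split-∷ 0 (withOnes-split (suc c) s h)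
withOnes-split (suc c) (suc (suc x) ∷ s) h       =
  withOnes-split-∷ (2 + x) (withOnes-split (suc c) s h)

¬Zeckendorf-dup : s ↭ x ∷ x ∷ r → ¬ IsZeckendorfOf n s
¬Zeckendorf-dup p (uniq , _) =
  Unique[x∷xs]⇒x∉xs (Setoid↭.Unique-resp-↭ (setoid ℕ) (↭⇒↭ₛ p) uniq) (here refl)

¬Zeckendorf-consecutive : s ↭ i ∷ suc i ∷ r → ¬ IsZeckendorfOf n s
¬Zeckendorf-consecutive p (_ , apart , _) =
  apart (∈-resp-↭ (↭-sym p) (here refl)) (∈-resp-↭ (↭-sym p) (there (here refl)))

¬Zeckendorf-ones : 2 ≤ ones s → ¬ IsZeckendorfOf n s
¬Zeckendorf-ones {s} h with _ , p ← withOnes-split 2 s h = ¬Zeckendorf-dup p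

∈⇒↭∷ : x ∈ s → ∃ λ r → s ↭ x ∷ r
∈⇒↭∷ {x} x∈s with ys , zs , refl ← ∈-∃++ x∈s = ys ++ zs , shift x ys zs

duplicate-or-unique : ∀ s → (∃ λ i → ∃ λ r → s ↭ i ∷ i ∷ r) ⊎ Unique s
duplicate-or-unique []      = inj₂ []
duplicate-or-unique (x ∷ s) with x ∈? s | duplicate-or-unique s
... | yes x∈s | _ with r , p ← ∈⇒↭∷ x∈s = inj₁ (x , r , prep x p)
... | no  x∉s | inj₁ (i , r , p) =
  inj₁ (i , x ∷ r , ↭-trans (prep x p) (↭-trans (swap x i ↭-refl) (prep i (swap x i ↭-refl))))
... | no  x∉s | inj₂ uniq = inj₂ (¬Any⇒All¬ s x∉s ∷ uniq)

consecutive-or-apart : ∀ s → (∃ λ i → ∃ λ r → s ↭ i ∷ suc i ∷ r) ⊎ (∀ {i} → i ∈ s → suc i ∉ s)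
consecutive-or-apart s with any? (λ x → suc x ∈? s) s
... | no none = inj₂ (λ i∈s 1+i∈s → none (lose i∈s 1+i∈s))
... | yes some with i , i∈s , 1+i∈s ← find some with r , p ← ∈⇒↭∷ i∈s
                with ∈-resp-↭ p 1+i∈s
...   | here 1+i≡i = ⊥-elim (1+n≢n 1+i≡i)
...   | there 1+i∈r with r' , p' ← ∈⇒↭∷ 1+i∈r = inj₁ (i , r' , ↭-trans p (prep i p'))

move-exists : Legal n s → ¬ IsZeckendorfOf n s → ∃ (Move s)
move-exists {s = s} (pos , val) ¬zeck with duplicate-or-unique s
... | inj₁ (i , r , p) = split-pair (All.lookup pos (∈-resp-↭ (↭-sym p) (here refl))) p
  where
  split-pair : ∀ {i} → 1 ≤ i → s ↭ i ∷ i ∷ r → ∃ (Move s)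
  split-pair {1}                 _ p = _ , split1 r p ↭-refl
  split-pair {2}                 _ p = _ , split2 r p ↭-refl
  split-pair {suc (suc (suc i))} _ p = _ , splitN (3 + i) r (s≤s (s≤s (s≤s z≤n))) p ↭-refl
... | inj₂ uniq with consecutive-or-apart s
...   | inj₂ apart = ⊥-elim (¬zeck (uniq , apart , val))
...   | inj₁ (i , r , p) = _ , combine i r (All.lookup pos (∈-resp-↭ (↭-sym p) (here refl))) p ↭-refl

module _ {n : ℕ} where

  Win-opponent-move : ¬ IsZeckendorfOf n s → ¬ T m → Win n T s m → Move s s' → Win n T s' (suc m)
  Win-opponent-move ¬zeck _   (ended zeck _)   _  = ⊥-elim (¬zeck zeck)
  Win-opponent-move _     ¬Tm (ours _ Tm _ _)  _  = ⊥-elim (¬Tm Tm)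
  Win-opponent-move _     _   (theirs _ _ win) mv = win _ mv

  Win-disjoint : Legal n s → (∀ x → A x → B x → ⊥) → Win n A s m → Win n B s m → ⊥
  Win-disjoint _ A∩B (ended _ Am)       (ended _ Bm)       = A∩B _ Am Bm
  Win-disjoint _ _   (ended zeck _)     (ours ¬zeck _ _ _) = ¬zeck zeck
  Win-disjoint _ _   (ended zeck _)     (theirs ¬zeck _ _) = ¬zeck zeck
  Win-disjoint _ _   (ours ¬zeck _ _ _) (ended zeck _)     = ¬zeck zeck
  Win-disjoint _ _   (theirs ¬zeck _ _) (ended zeck _)     = ¬zeck zeck
  Win-disjoint _ A∩B (ours _ Am _ _)    (ours _ Bm _ _)    = A∩B _ Am Bm
  Win-disjoint l A∩B (ours _ _ mv a)    (theirs _ _ b)     = Win-disjoint (legal-move mv l) A∩B a (b _ mv)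
  Win-disjoint l A∩B (theirs _ _ a)     (ours _ _ mv b)    = Win-disjoint (legal-move mv l) A∩B (a _ mv) b
  Win-disjoint l A∩B (theirs ¬zeck _ a) (theirs _ _ b) with s' , mv ← move-exists l ¬zeck =
    Win-disjoint (legal-move mv l) A∩B (a s' mv) (b s' mv)

  Win-shift : ∀ d → ¬ IsZeckendorfOf n s → Win n T s (d + m) → Win n (λ x → T (d + x)) s m
  Win-shift {T = T} d ¬zeck w = relabel w refl (λ zeck → ⊥-elim (¬zeck zeck))
    where
    -- A game that is already over can only be relabelled to a positive time,
    -- since 'ended' is indexed by the number of moves made.
    relabel : ∀ {s M m} → Win n T s M → M ≡ d + m → (IsZeckendorfOf n s → ∃ λ m' → m ≡ suc m')
            → Win n (λ x → T (d + x)) s m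
    relabel (ended zeck TM) e ended⇒pos with m' , refl ← ended⇒pos zeck =
      ended zeck (subst T (suc-injective (trans e (+-suc d m'))) TM)
    relabel (ours ¬zeck TM mv w) e _ =
      ours ¬zeck (subst T e TM) mv (relabel w (trans (cong suc e) (sym (+-suc d _))) (λ _ → _ , refl))
    relabel (theirs ¬zeck ¬TM win) e _ =
      theirs ¬zeck (λ Tm → ¬TM (subst T (sym e) Tm))
        (λ s' mv → relabel (win s' mv) (trans (cong suc e) (sym (+-suc d _))) (λ _ → _ , refl))

  ¬Win-at-both-times : ∀ d → Legal n s → ¬ IsZeckendorfOf n s → (∀ x → T x → T (d + x) → ⊥)
                     → Win n T s m → ¬ Win n T s (d + m)
  ¬Win-at-both-times d l ¬zeck disjoint w w' = Win-disjoint l disjoint w (Win-shift d ¬zeck w')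

  Win-some-move : 2 ≤ ones s → Win n T s m → ∃ λ s₁ → Move s s₁ × Win n T s₁ (suc m)
  Win-some-move 2≤ones     (ended zeck _)   = ⊥-elim (¬Zeckendorf-ones 2≤ones zeck)
  Win-some-move _          (ours _ _ mv w)  = _ , mv , w
  Win-some-move {s} 2≤ones (theirs _ _ win) with R , p ← withOnes-split 2 s 2≤ones =
    2 ∷ R , split1 R p ↭-refl , win _ (split1 R p ↭-refl)

private
  move-cost : ∀ d c → 2 * suc d + c ≡ 2 + (2 * d + c)
  move-cost = solve-∀

Win-advance : ∀ d {c} → Legal n s → 2 * d + c ≤ ones s → Win n T s m
            → ∃ λ s' → Legal n s' × c ≤ ones s' × Win n T s' (d + m)
Win-advance zero l h w = _ , l , h , w
Win-advance {n} {s} {T} {m} (suc d) {c} l h w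
  with h′ ← subst (_≤ ones s) (move-cost d c) h
  with s₁ , mv , w₁ ← Win-some-move (≤-trans (m≤m+n 2 _) h′) w
  with s' , l' , c≤ , w' ← Win-advance d (legal-move mv l)
                              (+-cancelˡ-≤ 2 _ _ (≤-trans h′ (ones-move mv))) w₁
  = s' , l' , c≤ , subst (Win n T s') (+-suc d m) w'

data Steer (n : ℕ) (T : ℕ → Set) : State → ℕ → State → ℕ → Set where
  stay : ∀ {s m} → Steer n T s m s m
  step : ∀ {s s₁ s' m m'} → ¬ IsZeckendorfOf n s → ¬ T m → Move s s₁
       → Steer n T s₁ (suc m) s' m' → Steer n T s m s' m'

data Quiet (T : ℕ → Set) : ℕ → ℕ → Set where
  []  : ∀ {m} → Quiet T m 0
  _∷_ : ∀ {m L} → ¬ T m → Quiet T (suc m) L → Quiet T m (suc L)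

quiet : ∀ L → (∀ z → z < L → ¬ T (z + m)) → Quiet T m L
quiet zero    _  = []
quiet {T = T} {m} (suc L) ¬T =
  ¬T 0 z<s ∷ quiet L (λ z z<L → subst (λ t → ¬ T t) (sym (+-suc z m)) (¬T (suc z) (s≤s z<L)))

Quiet-init : ∀ {L} → Quiet T m (suc L) → Quiet T m L
Quiet-init {L = zero}  _         = []
Quiet-init {L = suc L} (¬Tm ∷ q) = ¬Tm ∷ Quiet-init q

private
  pair-cost : ∀ j k c → 2 + j + suc k + c ≡ 3 + (j + k + c)
  pair-cost = solve-∀

  gadget-time₂ : ∀ g m → g + (2 + m) ≡ 2 + g + m
  gadget-time₂ = solve-∀

  gadget-time₃ : ∀ i g m → i + g + (3 + m) ≡ suc i + (2 + g) + m
  gadget-time₃ = solve-∀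

module _ {n : ℕ} {T : ℕ → Set} where

  Win-steer : ∀ {s m s' m'} → Steer n T s m s' m' → Win n T s m → Win n T s' m'
  Win-steer stay                  w = w
  Win-steer (step ¬zeck ¬Tm mv σ) w = Win-steer σ (Win-opponent-move ¬zeck ¬Tm w mv)

  legal-steer : ∀ {s m s' m'} → Steer n T s m s' m' → Legal n s → Legal n s'
  legal-steer stay            l = l
  legal-steer (step _ _ mv σ) l = legal-steer σ (legal-move mv l)

  steer-++ : ∀ {s m s₁ m₁ s' m'} → Steer n T s m s₁ m₁ → Steer n T s₁ m₁ s' m' → Steer n T s m s' m'
  steer-++ stay                  τ = τ
  steer-++ (step ¬zeck ¬Tm mv σ) τ = step ¬zeck ¬Tm mv (steer-++ σ τ)

  steer-1+1 : ∀ {s m u R} → s ↭ withOnes (2 + u) R → ¬ T m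
            → Steer n T s m (2 ∷ withOnes u R) (suc m)
  steer-1+1 p ¬Tm = step (¬Zeckendorf-dup p) ¬Tm (split1 _ p ↭-refl) stay

  steer-1+1+1 : ∀ {s m u R} → s ↭ withOnes (3 + u) R → ¬ T m → ¬ T (suc m)
              → Steer n T s m (withOnes u (3 ∷ R)) (2 + m)
  steer-1+1+1 {u = u} {R} p ¬T₀ ¬T₁ =
    step (¬Zeckendorf-dup p) ¬T₀ (split1 _ p ↭-refl)
      (step (¬Zeckendorf-consecutive 1+2) ¬T₁ (combine 1 _ ≤-refl 1+2 (withOnes-∷ u 3 R)) stay)
    where
    1+2 : 2 ∷ withOnes (1 + u) R ↭ 1 ∷ 2 ∷ withOnes u R
    1+2 = swap 2 1 ↭-refl

  steer-1+1+1+1 : ∀ {s m u R} → s ↭ withOnes (4 + u) R → ¬ T m → ¬ T (suc m) → ¬ T (2 + m)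
                → Steer n T s m (withOnes (1 + u) (3 ∷ R)) (3 + m)
  steer-1+1+1+1 {u = u} {R} p ¬T₀ ¬T₁ ¬T₂ =
    step (¬Zeckendorf-dup p) ¬T₀ (split1 _ p ↭-refl)
      (step (¬Zeckendorf-consecutive 1+2) ¬T₁ (split1 (2 ∷ withOnes u R) 1+1+2 ↭-refl)
        (step (¬Zeckendorf-dup ↭-refl) ¬T₂ (split2 _ ↭-refl (prep 1 (withOnes-∷ u 3 R))) stay))
    where
    1+2 : 2 ∷ withOnes (2 + u) R ↭ 1 ∷ 2 ∷ withOnes (1 + u) R
    1+2 = swap 2 1 ↭-refl
    1+1+2 : 2 ∷ withOnes (2 + u) R ↭ 1 ∷ 1 ∷ 2 ∷ withOnes u R
    1+1+2 = ↭-trans 1+2 (prep 1 (swap 2 1 ↭-refl))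

  steer-quiet : ∀ j {c s m} → j + ⌈ j /2⌉ + c ≤ ones s → Quiet T m j
              → ∃ λ s' → Steer n T s m s' (j + m) × c ≤ ones s'
  steer-quiet zero {s = s} h _ = s , stay , h
  steer-quiet 1    {s = s} h (¬Tm ∷ []) with R , p ← withOnes-split 2 s (≤-trans (m≤m+n 2 _) h) =
    2 ∷ R , steer-1+1 {u = 0} {R} p ¬Tm , +-cancelˡ-≤ 2 _ _ (≤-trans h (≤-reflexive (ones-↭ p)))
  steer-quiet (suc (suc j)) {c} {s} {m} h (¬T₀ ∷ ¬T₁ ∷ q)
    with h′ ← subst (_≤ ones s) (pair-cost j ⌈ j /2⌉ c) h
    with R , p ← withOnes-split 3 s (≤-trans (m≤m+n 3 _) h′)
    with s' , σ , c≤ ← steer-quiet j {s = 3 ∷ R}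
                          (+-cancelˡ-≤ 3 _ _ (≤-trans h′ (≤-reflexive (ones-↭ p)))) q =
    s' , subst (Steer n T s m s') (trans (+-suc j (suc m)) (cong suc (+-suc j m)))
           (steer-++ (steer-1+1+1 {u = 0} {R} p ¬T₀ ¬T₁) σ) , c≤

  steer-delay : ∀ g {u s} → suc (g * 3 + u) ≤ ones s
              → ∃ λ Z → suc u ≤ ones Z
                      × (∀ {m} → Quiet T m (g * 3) → ∀ i → i ≤ g → Steer n T s m Z (i + g * 2 + m))
  steer-delay zero {s = s} h = s , h , λ { _ zero z≤n → stay }
  steer-delay (suc g) {u} {s} h
    with R , p ← withOnes-split (4 + (g * 3 + u)) s h
    with Z , u<Z , σ ← steer-delay g {u} {withOnes (suc (g * 3 + u)) (3 ∷ R)}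
                         (≤-trans (m≤m+n _ _) (≤-reflexive (sym (ones-withOnes _ (3 ∷ R)))))
    = Z , u<Z , paths
    where
    paths : ∀ {m} → Quiet T m (suc g * 3) → ∀ i → i ≤ suc g → Steer n T s m Z (i + suc g * 2 + m)
    paths {m} (¬T₀ ∷ ¬T₁ ∷ ¬T₂ ∷ q) zero _ =
      subst (Steer n T s m Z) (gadget-time₂ (g * 2) m)
        (steer-++ (steer-1+1+1 {u = suc (g * 3 + u)} {R} p ¬T₀ ¬T₁) (σ (Quiet-init (¬T₂ ∷ q)) 0 z≤n))
    paths {m} (¬T₀ ∷ ¬T₁ ∷ ¬T₂ ∷ q) (suc i) (s≤s i≤g) =
      subst (Steer n T s m Z) (gadget-time₃ i (g * 2) m)
        (steer-++ (steer-1+1+1+1 {u = g * 3 + u} {R} p ¬T₀ ¬T₁ ¬T₂) (σ q i i≤g))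

  ¬Win-quiet : ∀ K {s m} → (∀ x → T x → T (K + x) → ⊥) → Legal n s → suc (K * 3 + 1) ≤ ones s
             → Quiet T m (K * 3) → ¬ Win n T s m
  ¬Win-quiet K {m = m} disjoint l h q w with Z , 2≤ones , σ ← steer-delay K {u = 1} h =
    ¬Win-at-both-times K (legal-steer (σ q 0 z≤n) l) (¬Zeckendorf-ones 2≤ones) disjoint
      (Win-steer (σ q 0 z≤n) w)
      (subst (Win n T Z) (+-assoc K (K * 2) m) (Win-steer (σ q K ≤-refl) w))

-- (y + (p ∸ a)) % p is the seat, counted from player a, of the player making move y.
module _ {p K a : ℕ} .{{_ : NonZero p}} (a≤p : a ≤ p) where

  InTeam⇒seat<K : ∀ {y} → K ≤ p → InTeam p K a y → (y + (p ∸ a)) % p < K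
  InTeam⇒seat<K {y} K≤p (i , i<K , q₁ , q₂ , e) = begin-strict
    (y + (p ∸ a)) % p            ≡⟨ [m+kn]%n≡m%n (y + (p ∸ a)) q₁ p ⟨
    (y + (p ∸ a) + q₁ * p) % p   ≡⟨ cong (_% p) rounds ⟩
    (i + suc q₂ * p) % p         ≡⟨ [m+kn]%n≡m%n i (suc q₂) p ⟩
    i % p                        ≡⟨ m<n⇒m%n≡m (≤-trans i<K K≤p) ⟩
    i                            <⟨ i<K ⟩
    K                            ∎
    where
    open ≤-Reasoning
    shuffle₁ : ∀ y d x → y + d + x ≡ y + x + d
    shuffle₁ = solve-∀
    shuffle₂ : ∀ a i x d → a + i + x + d ≡ i + ((a + d) + x)
    shuffle₂ = solve-∀
    rounds : y + (p ∸ a) + q₁ * p ≡ i + suc q₂ * p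
    rounds = begin-equality
      y + (p ∸ a) + q₁ * p         ≡⟨ shuffle₁ y (p ∸ a) (q₁ * p) ⟩
      y + q₁ * p + (p ∸ a)         ≡⟨ cong (_+ (p ∸ a)) e ⟩
      a + i + q₂ * p + (p ∸ a)     ≡⟨ shuffle₂ a i (q₂ * p) (p ∸ a) ⟩
      i + (a + (p ∸ a) + q₂ * p)   ≡⟨ cong (λ x → i + (x + q₂ * p)) (m+[n∸m]≡n a≤p) ⟩
      i + suc q₂ * p               ∎

  ¬InTeam : ∀ {y} j c → K ≤ p → y + (p ∸ a) ≡ j + c * p → K ≤ j → j < p → ¬ InTeam p K a y
  ¬InTeam {y} j c K≤p e K≤j j<p member =
    <⇒≱ (InTeam⇒seat<K K≤p member) (subst (K ≤_) (sym seat≡j) K≤j)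
    where
    seat≡j : (y + (p ∸ a)) % p ≡ j
    seat≡j = trans (cong (_% p) e) (trans ([m+kn]%n≡m%n j c p) (m<n⇒m%n≡m j<p))

  InTeam-disjoint-+ : K + K ≤ p → ∀ y → InTeam p K a y → ¬ InTeam p K a (K + y)
  InTeam-disjoint-+ 2K≤p y member =
    ¬InTeam (K + seat) ((y + (p ∸ a)) / p) K≤p next-seat (m≤m+n K seat)
      (≤-trans (+-monoʳ-< K (InTeam⇒seat<K K≤p member)) 2K≤p)
    where
    K≤p : K ≤ p
    K≤p = ≤-trans (m≤m+n K K) 2K≤p
    seat : ℕ
    seat = (y + (p ∸ a)) % p
    next-seat : K + y + (p ∸ a) ≡ K + seat + (y + (p ∸ a)) / p * p
    next-seat = trans (+-assoc K y _) (trans (cong (K +_) (m≡m%n+[m/n]*n _ p)) (sym (+-assoc K seat _)))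

private
  ⌈n/2⌉-double : ∀ n → 2 * ⌈ n /2⌉ ≤ suc n
  ⌈n/2⌉-double 0             = z≤n
  ⌈n/2⌉-double 1             = ≤-refl
  ⌈n/2⌉-double (suc (suc n)) = subst (_≤ 3 + n) (sym (*-suc 2 ⌈ n /2⌉)) (s≤s (s≤s (⌈n/2⌉-double n)))

module _ {n p K a : ℕ} (2≤K : 2 ≤ K) (4K≤p : 4 * K ≤ p) (10K≤n : 10 * K ≤ n) (a<p : a < p) where

  private
    instance
      p≢0 : NonZero p
      p≢0 = >-nonZero (≤-<-trans z≤n a<p)

    Team : ℕ → Set
    Team = InTeam p K a

    D : ℕ
    D = p ∸ a

    a+D≡p : a + D ≡ p
    a+D≡p = m+[n∸m]≡n (<⇒≤ a<p)

    3K+K≤p : K * 3 + K ≤ p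
    3K+K≤p = ≤-trans (≤-reflexive (four K)) 4K≤p
      where
      four : ∀ K → K * 3 + K ≡ 4 * K
      four = solve-∀

    ¬Team-seat : ∀ {y} j c → y + D ≡ j + c * p → K ≤ j → j < p → ¬ Team y
    ¬Team-seat j c = ¬InTeam (<⇒≤ a<p) j c (≤-trans (m≤n+m K (K * 3)) 3K+K≤p)

    ¬Team-seat₀ : ∀ {y} → K ≤ y + D → y + D < p → ¬ Team y
    ¬Team-seat₀ {y} = ¬Team-seat (y + D) 0 (sym (+-identityʳ (y + D)))

    ¬Team-before : a + K ≤ p → ∀ {y} → y < a → ¬ Team y
    ¬Team-before a+K≤p {y} y<a =
      ¬Team-seat₀ (≤-trans K≤D (m≤n+m D y)) (subst (y + D <_) a+D≡p (+-monoˡ-< D y<a))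
      where
      K≤D : K ≤ D
      K≤D = +-cancelˡ-≤ a K D (≤-trans a+K≤p (≤-reflexive (sym a+D≡p)))

    ≤-ones-start : ∀ {c} → c ≤ n → c ≤ ones (start n)
    ≤-ones-start c≤n = ≤-trans c≤n (≤-reflexive (sym (ones-start n)))

    -- K gadgets spend 3K ones; two more keep the final position non-terminal.
    reserve : ℕ
    reserve = suc (K * 3 + 1)

    2K+reserve≤n : 2 * K + reserve ≤ n
    2K+reserve≤n = begin
      2 * K + reserve   ≡⟨ five K ⟩
      5 * K + 2         ≤⟨ +-monoʳ-≤ (5 * K) (≤-trans 2≤K (m≤m+n K (4 * K))) ⟩
      5 * K + 5 * K     ≡⟨ ten K ⟩
      10 * K            ≤⟨ 10K≤n ⟩
      n                 ∎
      where
      open ≤-Reasoning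
      five : ∀ K → 2 * K + suc (K * 3 + 1) ≡ 5 * K + 2
      five = solve-∀
      ten : ∀ K → 5 * K + 5 * K ≡ 10 * K
      ten = solve-∀

    ¬Win-after : ∀ d {s m} → Legal n s → 2 * d + reserve ≤ ones s
               → (∀ z → z < K * 3 → ¬ Team (z + (d + m))) → ¬ Win n Team s m
    ¬Win-after d l h quiet-times w with s' , l' , h' , w' ← Win-advance d l h w =
      ¬Win-quiet K disjoint l' h' (quiet (K * 3) quiet-times) w'
      where
      disjoint : ∀ x → Team x → Team (K + x) → ⊥
      disjoint = InTeam-disjoint-+ (<⇒≤ a<p) (≤-trans (+-monoʳ-≤ K (m≤m+n K (2 * K))) 4K≤p)

    early-budget : a < K * 3 → a + ⌈ a /2⌉ + (2 * K + reserve) ≤ n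
    early-budget a<3K = *-cancelˡ-≤ 2 (begin
      2 * (a + ⌈ a /2⌉ + (2 * K + reserve))  ≡⟨ e₁ a ⌈ a /2⌉ K ⟩
      2 * ⌈ a /2⌉ + (2 * a + 10 * K + 4)     ≤⟨ +-monoˡ-≤ _ (⌈n/2⌉-double a) ⟩
      suc a + (2 * a + 10 * K + 4)           ≡⟨ e₂ a K ⟩
      3 * suc a + 10 * K + 2                 ≤⟨ +-monoˡ-≤ 2 (+-monoˡ-≤ (10 * K) (*-monoʳ-≤ 3 a<3K)) ⟩
      3 * (K * 3) + 10 * K + 2               ≡⟨ e₃ K ⟩
      19 * K + 2                             ≤⟨ +-monoʳ-≤ (19 * K) 2≤K ⟩
      19 * K + K                             ≡⟨ e₄ K ⟩
      2 * (10 * K)                           ≤⟨ *-monoʳ-≤ 2 10K≤n ⟩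
      2 * n                                  ∎)
      where
      open ≤-Reasoning
      e₁ : ∀ a c K → 2 * (a + c + (2 * K + suc (K * 3 + 1))) ≡ 2 * c + (2 * a + 10 * K + 4)
      e₁ = solve-∀
      e₂ : ∀ a K → suc a + (2 * a + 10 * K + 4) ≡ 3 * suc a + 10 * K + 2
      e₂ = solve-∀
      e₃ : ∀ K → 3 * (K * 3) + 10 * K + 2 ≡ 19 * K + 2
      e₃ = solve-∀
      e₄ : ∀ K → 19 * K + K ≡ 2 * (10 * K)
      e₄ = solve-∀

    ¬Team-after-team : ∀ z → z < K * 3 → ¬ Team (z + (K + (a + 0)))
    ¬Team-after-team z z<3K =
      ¬Team-seat (z + K) 1 next-round (m≤n+m K z) (<-≤-trans (+-monoˡ-< K z<3K) 3K+K≤p)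
      where
      open ≡-Reasoning
      regroup : ∀ z K a D → z + (K + (a + 0)) + D ≡ z + K + (a + D)
      regroup = solve-∀
      next-round : z + (K + (a + 0)) + D ≡ z + K + 1 * p
      next-round = begin
        z + (K + (a + 0)) + D   ≡⟨ regroup z K a D ⟩
        z + K + (a + D)         ≡⟨ cong (z + K +_) (trans a+D≡p (sym (*-identityˡ p))) ⟩
        z + K + 1 * p           ∎

    a<3K⇒a+K≤p : a < K * 3 → a + K ≤ p
    a<3K⇒a+K≤p a<3K = ≤-trans (+-monoˡ-≤ K (<⇒≤ a<3K)) 3K+K≤p

    ¬Win-team-early : a < K * 3 → ¬ Win n Team (start n) 0
    ¬Win-team-early a<3K win
      with s₁ , σ , h₁ ← steer-quiet a (≤-ones-start (early-budget a<3K))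
                           (quiet a (λ z z<a → ¬Team-before (a<3K⇒a+K≤p a<3K)
                                                 (subst (_< a) (sym (+-identityʳ z)) z<a)))
      = ¬Win-after K (legal-steer σ (legal-start n)) h₁ ¬Team-after-team (Win-steer σ win)

    ¬Win-team-late : K * 3 ≤ a → a + K ≤ p → ¬ Win n Team (start n) 0
    ¬Win-team-late 3K≤a a+K≤p = ¬Win-after 0 (legal-start n) budget
      λ z z<3K → ¬Team-before a+K≤p (<-≤-trans (subst (_< K * 3) (sym (+-identityʳ z)) z<3K) 3K≤a)
      where
      budget : reserve ≤ ones (start n)
      budget = ≤-ones-start (≤-trans (m≤n+m reserve (2 * K)) 2K+reserve≤n)

    ¬Win-team-wraps : p < a + K → ¬ Win n Team (start n) 0
    ¬Win-team-wraps p<a+K = ¬Win-after d (legal-start n) budget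
      λ z z<3K → ¬Team-seat₀ (subst (K ≤_) (sym (settle z)) (m≤n+m K z))
                   (subst (_< p) (sym (settle z)) (<-≤-trans (+-monoˡ-< K z<3K) 3K+K≤p))
      where
      d : ℕ
      d = a + K ∸ p
      d≤K : d ≤ K
      d≤K = ≤-trans (∸-monoˡ-≤ p (+-monoˡ-≤ K (<⇒≤ a<p))) (≤-reflexive (m+n∸m≡n p K))
      d+D≡K : d + D ≡ K
      d+D≡K = +-cancelʳ-≡ a (d + D) K (begin
        d + D + a     ≡⟨ +-assoc d D a ⟩
        d + (D + a)   ≡⟨ cong (d +_) (trans (+-comm D a) a+D≡p) ⟩
        d + p         ≡⟨ m∸n+n≡m (<⇒≤ p<a+K) ⟩
        a + K         ≡⟨ +-comm a K ⟩
        K + a         ∎)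
        where open ≡-Reasoning
      settle : ∀ z → z + (d + 0) + D ≡ z + K
      settle z = trans (regroup z d D) (cong (z +_) d+D≡K)
        where
        regroup : ∀ z d D → z + (d + 0) + D ≡ z + (d + D)
        regroup = solve-∀
      budget : 2 * d + reserve ≤ ones (start n)
      budget = ≤-ones-start (≤-trans (+-monoˡ-≤ reserve (*-monoʳ-≤ 2 d≤K)) 2K+reserve≤n)

  ¬HasWinningStrategy : ¬ HasWinningStrategy n p K a
  ¬HasWinningStrategy with a <? K * 3 | a + K ≤? p
  ... | yes a<3K | _         = ¬Win-team-early a<3K
  ... | no  a≮3K | yes a+K≤p = ¬Win-team-late (≮⇒≥ a≮3K) a+K≤p
  ... | no  _    | no  a+K≰p = ¬Win-team-wraps (≰⇒> a+K≰p)

lemma2p2p1 : ∀ (t k n : ℕ) → 4 ≤ t → k ≡ t ∸ 1 → 2 * (k * k) + 4 * k ≤ n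
           → ∀ (a : ℕ) → a < t * k
           → ¬ HasWinningStrategy n (t * k) k a
lemma2p2p1 (suc k) .k n 4≤t refl n≥2k²+4k a a<p =
  ¬HasWinningStrategy (≤-trans (n≤1+n 2) 3≤k) (*-monoˡ-≤ k 4≤t) 10k≤n a<p
  where
  3≤k : 3 ≤ k
  3≤k = ≤-pred 4≤t
  10k≤n : 10 * k ≤ n
  10k≤n = begin
    10 * k                ≡⟨ ten k ⟩
    2 * (3 * k) + 4 * k   ≤⟨ +-monoˡ-≤ (4 * k) (*-monoʳ-≤ 2 (*-monoˡ-≤ k 3≤k)) ⟩
    2 * (k * k) + 4 * k   ≤⟨ n≥2k²+4k ⟩
    n                     ∎
    where
    open ≤-Reasoning
    ten : ∀ k → 10 * k ≡ 2 * (3 * k) + 4 * k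
    ten = solve-∀
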